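{- Let $R_1,\ldots,R_n\subseteq\Omega$ satisfy $R_1\uplus\cdots\uplus R_n=\Omega$. Then for every formula $A$ of LMRL, $\vdash R_1\{A\},\ldots,R_n\{A\}$ is derivable in LMRL.
   Context: Fix a set $\Omega$ of roles (possibly infinite). A role set is a subset $R\subseteq\Omega$; $\overline{R}=\Omega\setminus R$; $R_1\uplus\cdots\uplus R_n=\Omega$ means the $R_i$ are pairwise disjoint with union $\Omega$. An ultrafilter on $\Omega$ is a family $\mathcal U$ of subsets of $\Omega$ with $\Omega\in\mathcal U$, closed upward and under binary intersection, and containing $R$ or $\overline R$ for every $R$. For an endomorphism $f$ of $\Omega$, $f^{ -1}(R)=\{r\mid f(r)\in R\}$. Formulas of LMRL, over first-order terms $t$ and variables $x$: $A,B::=a\mid\neg_f(A)\mid A\otimes_{\mathcal U}B\mid A\,\&_{\mathcal U}B\mid !_{\mathcal U}(A)\mid\forall_{\mathcal U}(\lambda x.A)$ ($a$ primitive, $f$ endomorphisms, $\mathcal U$ ultrafilters); $A[x:=t]$ is substitution. An i-formula is $R\{A\}$; a sequent is a finite multiset of i-formulas. $?(\Gamma)$ denotes a sequent every i-formula of which has the form $R\{!_{\mathcal U}(C)\}$ with $R\notin\mathcal U$. Rules of LMRL: (Id) $\vdash R_1\{a\},\ldots,R_n\{a\}$ whenever $R_1\uplus\cdots\uplus R_n=\Omega$; ($\neg$) from $\Gamma,f^{ -1}(R)\{A\}$ infer $\Gamma,R\{\neg_f(A)\}$; ($\&$-neg-l/r) if $R\notin\mathcal U$, from $\Gamma,R\{A\}$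 (resp. $\Gamma,R\{B\}$) infer $\Gamma,R\{A\,\&_{\mathcal U}B\}$; ($\&$-pos) if $R\in\mathcal U$, from $\Gamma,R\{A\}$ and $\Gamma,R\{B\}$ infer $\Gamma,R\{A\,\&_{\mathcal U}B\}$; ($\otimes$-neg) if $R\notin\mathcal U$, from $\Gamma,R\{A\},R\{B\}$ infer $\Gamma,R\{A\otimes_{\mathcal U}B\}$; ($\otimes$-pos) if $R\in\mathcal U$, from $\Gamma_1,R\{A\}$ and $\Gamma_2,R\{B\}$ infer $\Gamma_1,\Gamma_2,R\{A\otimes_{\mathcal U}B\}$; ($!$-pos) if $R\in\mathcal U$, from $?(\Gamma),R\{A\}$ infer $?(\Gamma),R\{!_{\mathcal U}(A)\}$; ($!$-neg-weaken) if $R\notin\mathcal U$, from $\Gamma$ infer $\Gamma,R\{!_{\mathcal U}(A)\}$; ($!$-neg-derelict) if $R\notin\mathcal U$, from $\Gamma,R\{A\}$ infer $\Gamma,R\{!_{\mathcal U}(A)\}$; ($!$-neg-contract) if $R\notin\mathcal U$, from $\Gamma,R\{!_{\mathcal U}(A)\},R\{!_{\mathcal U}(A)\}$ infer $\Gamma,R\{!_{\mathcal U}(A)\}$; ($\forall$-neg) if $R\notin\mathcal U$, from $\Gamma,R\{A[x:=t]\}$ infer $\Gamma,R\{\forall_{\mathcal U}(\lambda x.A)\}$; ($\forall$-pos) if $R\in\mathcal U$ and $x$ not free in $\Gamma$, from $\Gamma,R\{A\}$ infer $\Gamma,R\{\forall_{\mathcal U}(\lambda x.A)\}$. -}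

module Defs where

open import Data.Bool using (Bool; true; false; not; _∧_; if_then_else_)
open import Data.Nat using (ℕ; _≟_)
open import Data.Fin using (Fin)
open import Data.List using (List; []; _∷_; _++_; filter; concatMap; tabulate)
open import Data.List.Membership.Propositional using (_∉_)
open import Data.List.Relation.Unary.All using (All)
open import Data.List.Relation.Binary.Permutation.Propositional using (_↭_)
open import Data.Product using (Σ; _×_)
open import Data.Sum using (_⊎_)
open import Data.Unit using (⊤)
open import Relation.Nullary using (¬_; does; ¬?)
open import Relation.Binary.PropositionalEquality using (_≡_)

-- Ω : the set of roles; Fun, Pred : function and predicate symbols of the
-- first-order language. Variables are natural numbers.
module LMRL (Ω : Set) (Fun Pred : Set) where

  RoleSet : Set
  RoleSet = Ω → Bool

  full empty : RoleSet
  full _ = true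
  empty _ = false

  ∁ : RoleSet → RoleSet
  ∁ R r = not (R r)

  _∩_ : RoleSet → RoleSet → RoleSet
  (R ∩ S) r = R r ∧ S r

  _⊆_ : RoleSet → RoleSet → Set
  R ⊆ S = ∀ r → R r ≡ true → S r ≡ true

  preimage : (Ω → Ω) → RoleSet → RoleSet
  preimage f R r = R (f r)

  -- R₁ ⊎ ⋯ ⊎ Rₙ = Ω : pairwise disjoint and covering Ω
  Partition : {n : ℕ} → (Fin n → RoleSet) → Set
  Partition {n} R =
    (∀ r → Σ (Fin n) λ i → R i r ≡ true) ×
    (∀ i j r → R i r ≡ true → R j r ≡ true → i ≡ j)

  record Ultrafilter : Set₁ where
    field
      mem       : RoleSet → Set
      mem-full  : mem full
      mem-up    : ∀ {R S} → mem R → R ⊆ S → mem S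
      mem-∩     : ∀ {R S} → mem R → mem S → mem (R ∩ S)
      mem-ultra : ∀ R → mem R ⊎ mem (∁ R)
      proper    : ¬ mem empty
  open Ultrafilter public

  Var : Set
  Var = ℕ

  data Term : Set where
    var : Var → Term
    app : Fun → List Term → Term

  data Formula : Set₁ where
    prim   : Pred → List Term → Formula
    neg    : (Ω → Ω) → Formula → Formula
    tensor : Ultrafilter → Formula → Formula → Formula
    with&  : Ultrafilter → Formula → Formula → Formula
    bang   : Ultrafilter → Formula → Formula
    forAll : Ultrafilter → Var → Formula → Formula

  substT  : Term → Var → Term → Term
  substTs : List Term → Var → Term → List Term
  substT (var y) x t = if does (y ≟ x) then t else var y
  substT (app g us) x t = app g (substTs us x t)
  substTs [] x t = []
  substTs (u ∷ us) x t = substT u x t ∷ substTs us x t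

  fvT  : Term → List Var
  fvTs : List Term → List Var
  fvT (var y) = y ∷ []
  fvT (app g us) = fvTs us
  fvTs [] = []
  fvTs (u ∷ us) = fvT u ++ fvTs us

  fv : Formula → List Var
  fv (prim p us) = fvTs us
  fv (neg f A) = fv A
  fv (tensor U A B) = fv A ++ fv B
  fv (with& U A B) = fv A ++ fv B
  fv (bang U A) = fv A
  fv (forAll U y A) = filter (λ z → ¬? (z ≟ y)) (fv A)

  _[_≔_] : Formula → Var → Term → Formula
  prim p us [ x ≔ t ] = prim p (substTs us x t)
  neg f A [ x ≔ t ] = neg f (A [ x ≔ t ])
  tensor U A B [ x ≔ t ] = tensor U (A [ x ≔ t ]) (B [ x ≔ t ])
  with& U A B [ x ≔ t ] = with& U (A [ x ≔ t ]) (B [ x ≔ t ])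
  bang U A [ x ≔ t ] = bang U (A [ x ≔ t ])
  forAll U y A [ x ≔ t ] =
    if does (y ≟ x) then forAll U y A else forAll U y (A [ x ≔ t ])

  FreeFor : Term → Var → Formula → Set
  FreeFor t x (prim p us) = ⊤
  FreeFor t x (neg f A) = FreeFor t x A
  FreeFor t x (tensor U A B) = FreeFor t x A × FreeFor t x B
  FreeFor t x (with& U A B) = FreeFor t x A × FreeFor t x B
  FreeFor t x (bang U A) = FreeFor t x A
  FreeFor t x (forAll U y A) =
    (x ∉ fv (forAll U y A)) ⊎ ((y ∉ fvT t) × FreeFor t x A)

  data IFormula : Set₁ where
    _⟦_⟧ : RoleSet → Formula → IFormula

  -- sequents: finite multisets, represented as lists up to permutation
  Sequent : Set₁
  Sequent = List IFormula

  fvI : IFormula → List Var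
  fvI (R ⟦ A ⟧) = fv A

  fvSeq : Sequent → List Var
  fvSeq = concatMap fvI

  -- shape of ?(Γ): R{!_U(C)} with R ∉ U
  WhyNot : IFormula → Set₁
  WhyNot (R ⟦ A ⟧) = Σ Ultrafilter λ U → Σ Formula λ C →
    (A ≡ bang U C) × (¬ mem U R)

  infix 2 ⊢_
  data ⊢_ : Sequent → Set₁ where
    exch : ∀ {Γ Δ} → Γ ↭ Δ → ⊢ Γ → ⊢ Δ
    Id : ∀ {n} (R : Fin n → RoleSet) → Partition R → ∀ p us →
      ⊢ tabulate (λ i → R i ⟦ prim p us ⟧)
    ¬-rule : ∀ {Γ R f A} → ⊢ (preimage f R ⟦ A ⟧ ∷ Γ) → ⊢ (R ⟦ neg f A ⟧ ∷ Γ)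
    &-neg-l : ∀ {Γ R U A B} → ¬ mem U R →
      ⊢ (R ⟦ A ⟧ ∷ Γ) → ⊢ (R ⟦ with& U A B ⟧ ∷ Γ)
    &-neg-r : ∀ {Γ R U A B} → ¬ mem U R →
      ⊢ (R ⟦ B ⟧ ∷ Γ) → ⊢ (R ⟦ with& U A B ⟧ ∷ Γ)
    &-pos : ∀ {Γ R U A B} → mem U R →
      ⊢ (R ⟦ A ⟧ ∷ Γ) → ⊢ (R ⟦ B ⟧ ∷ Γ) → ⊢ (R ⟦ with& U A B ⟧ ∷ Γ)
    ⊗-neg : ∀ {Γ R U A B} → ¬ mem U R →
      ⊢ (R ⟦ A ⟧ ∷ R ⟦ B ⟧ ∷ Γ) → ⊢ (R ⟦ tensor U A B ⟧ ∷ Γ)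
    ⊗-pos : ∀ {Γ₁ Γ₂ R U A B} → mem U R →
      ⊢ (R ⟦ A ⟧ ∷ Γ₁) → ⊢ (R ⟦ B ⟧ ∷ Γ₂) →
      ⊢ (R ⟦ tensor U A B ⟧ ∷ Γ₁ ++ Γ₂)
    !-pos : ∀ {Γ R U A} → mem U R → All WhyNot Γ →
      ⊢ (R ⟦ A ⟧ ∷ Γ) → ⊢ (R ⟦ bang U A ⟧ ∷ Γ)
    !-neg-weaken : ∀ {Γ R U A} → ¬ mem U R →
      ⊢ Γ → ⊢ (R ⟦ bang U A ⟧ ∷ Γ)
    !-neg-derelict : ∀ {Γ R U A} → ¬ mem U R →
      ⊢ (R ⟦ A ⟧ ∷ Γ) → ⊢ (R ⟦ bang U A ⟧ ∷ Γ)
    !-neg-contract : ∀ {Γ R U A} → ¬ mem U R →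
      ⊢ (R ⟦ bang U A ⟧ ∷ R ⟦ bang U A ⟧ ∷ Γ) → ⊢ (R ⟦ bang U A ⟧ ∷ Γ)
    ∀-neg : ∀ {Γ R U x A} (t : Term) → ¬ mem U R → FreeFor t x A →
      ⊢ (R ⟦ A [ x ≔ t ] ⟧ ∷ Γ) → ⊢ (R ⟦ forAll U x A ⟧ ∷ Γ)
    ∀-pos : ∀ {Γ R U x A} → mem U R → x ∉ fvSeq Γ →
      ⊢ (R ⟦ A ⟧ ∷ Γ) → ⊢ (R ⟦ forAll U x A ⟧ ∷ Γ)

-- Proof by induction on A, for all partitions at once. Prime formulas are axioms
-- and ¬_f passes to the partition (f⁻¹(Rᵢ))ᵢ. For a connective indexed by an
-- ultrafilter U, exactly one block Rᵢ of the partition lies in U: Rᵢ receives the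
-- positive rule and every other block the matching negative rule, so each block
-- ends up with one premise of the induction hypothesis, for the same partition
-- (under ∀, the other blocks instantiate the bound variable by itself).
module Submission where

open import Defs
open import Data.Bool using (true; if_then_else_)
open import Data.Bool.Properties using (∧-conicalˡ; ∧-conicalʳ; not-¬)
open import Data.Empty using (⊥; ⊥-elim)
open import Data.Fin using (Fin; zero; suc; punchIn; _≟_)
open import Data.Fin.Properties using (¬Fin0; punchInᵢ≢i)
open import Data.List using ([]; _∷_; _++_; tabulate)
open import Data.List.Properties using (++-assoc; ++-identityʳ)
open import Data.List.Membership.Propositional using (_∉_)
open import Data.List.Membership.Propositional.Properties using (∈-concatMap⁻; ∈-filter⁻)
open import Data.List.Relation.Unary.All using (All)
open import Data.List.Relation.Unary.All.Properties using (All¬⇒¬Any; tabulate⁺)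
open import Data.List.Relation.Unary.Any using (here; there)
open import Data.List.Relation.Binary.Permutation.Propositional
  using (_↭_; ↭-refl; ↭-sym; ↭-trans; ↭-reflexive; prep; swap)
open import Data.List.Relation.Binary.Permutation.Propositional.Properties using (shift; shifts; ++⁺ʳ)
open import Data.Nat using (ℕ; zero; suc)
import Data.Nat as ℕ
open import Data.Product using (Σ; _×_; _,_; proj₁; proj₂)
open import Data.Sum using (inj₁; inj₂)
open import Function using (_∘_)
open import Relation.Nullary using (¬_; ¬?; Dec; does; yes; no)
open import Relation.Binary.PropositionalEquality using (_≡_; refl; sym; trans; cong; cong₂; subst)

focus : ∀ {a} {A : Set a} {m} (F : Fin (suc m) → A) (i : Fin (suc m)) →
  tabulate F ↭ F i ∷ tabulate (F ∘ punchIn i)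
focus F zero = ↭-refl
focus {m = zero} F (suc ())
focus {m = suc m} F (suc i) = ↭-trans (prep (F zero) (focus (F ∘ suc) i)) (swap _ _ ↭-refl)

if-does-≡ : ∀ {p a} {P : Set p} {A : Set a} (d : Dec P) {t e c : A} →
  (P → t ≡ c) → e ≡ c → (if does d then t else e) ≡ c
if-does-≡ (yes p) t≡c _ = t≡c p
if-does-≡ (no _) _ e≡c = e≡c

module IdentityExpansion (Ω Fun Pred : Set) where
  open LMRL Ω Fun Pred

  module _ (U : Ultrafilter) where

    mem-cover : ∀ {n} (R : Fin n → RoleSet) {S : RoleSet} → mem U S →
      (∀ r → S r ≡ true → Σ (Fin n) λ i → R i r ≡ true) →
      Σ (Fin n) λ i → mem U (R i)
    mem-cover {zero} R S∈U cover =
      ⊥-elim (proper U (mem-up U S∈U λ r Sr → ⊥-elim (¬Fin0 (proj₁ (cover r Sr)))))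
    mem-cover {suc n} R {S} S∈U cover with mem-ultra U (R zero)
    ... | inj₁ R₀∈U = zero , R₀∈U
    ... | inj₂ ∁R₀∈U with mem-cover (R ∘ suc) (mem-∩ U S∈U ∁R₀∈U) cover-rest
      where
      cover-rest : ∀ r → (S ∩ ∁ (R zero)) r ≡ true → Σ (Fin n) λ i → R (suc i) r ≡ true
      cover-rest r h with cover r (∧-conicalˡ _ _ h)
      ... | zero , R₀r = ⊥-elim (not-¬ refl (trans R₀r (sym (∧-conicalʳ _ _ h))))
      ... | suc i , Rᵢr = i , Rᵢr
    ... | i , Rᵢ∈U = suc i , Rᵢ∈U

    mem-disjoint : ∀ {R S} → mem U R → mem U S → ¬ (∀ r → R r ≡ true → S r ≡ true → ⊥)
    mem-disjoint R∈U S∈U disjoint = proper U (mem-up U (mem-∩ U R∈U S∈U)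
      λ r h → ⊥-elim (disjoint r (∧-conicalˡ _ _ h) (∧-conicalʳ _ _ h)))

    module _ {n} {R : Fin n → RoleSet} (P : Partition R) where

      block : Σ (Fin n) λ i → mem U (R i)
      block = mem-cover R (mem-full U) (λ r _ → proj₁ P r)

      block-unique : ∀ {i k} → mem U (R i) → mem U (R k) → i ≡ k
      block-unique {i} {k} Rᵢ∈U Rₖ∈U with i ≟ k
      ... | yes i≡k = i≡k
      ... | no i≢k = ⊥-elim (mem-disjoint Rᵢ∈U Rₖ∈U λ r a b → i≢k (proj₂ P i k r a b))

  principal-block : ∀ {m} {R : Fin (suc m) → RoleSet} → Partition R → (U : Ultrafilter) →
    Σ (Fin (suc m)) λ i → mem U (R i) × (∀ j → ¬ mem U (R (punchIn i j)))
  principal-block P U =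
    let i , Rᵢ∈U = block U P
    in i , Rᵢ∈U , λ j Rⱼ∈U → punchInᵢ≢i i j (block-unique U P Rⱼ∈U Rᵢ∈U)

  preimage-partition : ∀ {n} {R : Fin n → RoleSet} (f : Ω → Ω) →
    Partition R → Partition (preimage f ∘ R)
  preimage-partition f (cover , disjoint) = cover ∘ f , λ i j r → disjoint i j (f r)

  infix 4 _⇝_
  _⇝_ : Sequent → Sequent → Set₁
  Γ ⇝ Δ = ∀ Θ → ⊢ Γ ++ Θ → ⊢ Δ ++ Θ

  ⇝-refl : ∀ {Γ} → Γ ⇝ Γ
  ⇝-refl Θ d = d

  ⇝-trans : ∀ {Γ Δ Ξ} → Γ ⇝ Δ → Δ ⇝ Ξ → Γ ⇝ Ξ
  ⇝-trans f g Θ = g Θ ∘ f Θ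

  ↭⇒⇝ : ∀ {Γ Δ} → Γ ↭ Δ → Γ ⇝ Δ
  ↭⇒⇝ p Θ = exch (++⁺ʳ Θ p)

  ⇝-++ : ∀ {Γ₁ Γ₂ Δ₁ Δ₂} → Γ₁ ⇝ Δ₁ → Γ₂ ⇝ Δ₂ → Γ₁ ++ Γ₂ ⇝ Δ₁ ++ Δ₂
  ⇝-++ {Γ₁} {Γ₂} {Δ₁} {Δ₂} f g Θ =
    exch (↭-reflexive (sym (++-assoc Δ₁ Δ₂ Θ))) ∘ exch (shifts Δ₂ Δ₁) ∘ g (Δ₁ ++ Θ)
      ∘ exch (shifts Δ₁ Γ₂) ∘ f (Γ₂ ++ Θ) ∘ exch (↭-reflexive (++-assoc Γ₁ Γ₂ Θ))

  ⇝-tabulate : ∀ {m} {F G : Fin m → IFormula} →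
    (∀ j → F j ∷ [] ⇝ G j ∷ []) → tabulate F ⇝ tabulate G
  ⇝-tabulate {zero} r = ⇝-refl
  ⇝-tabulate {suc m} r = ⇝-++ (r zero) (⇝-tabulate (r ∘ suc))

  ⇝-tabulate₂ : ∀ {m} {F G H : Fin m → IFormula} →
    (∀ j → F j ∷ G j ∷ [] ⇝ H j ∷ []) → tabulate F ++ tabulate G ⇝ tabulate H
  ⇝-tabulate₂ {zero} r = ⇝-refl
  ⇝-tabulate₂ {suc m} {F} {G} r =
    ⇝-trans (↭⇒⇝ (prep (F zero) (shift (G zero) (tabulate (F ∘ suc)) (tabulate (G ∘ suc)))))
            (⇝-++ (r zero) (⇝-tabulate₂ (r ∘ suc)))

  ⇝-run : ∀ {Γ Δ} → Γ ⇝ Δ → ⊢ Γ → ⊢ Δ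
  ⇝-run {Γ} {Δ} f =
    exch (↭-reflexive (++-identityʳ Δ)) ∘ f [] ∘ exch (↭-reflexive (sym (++-identityʳ Γ)))

  substT-self : ∀ u x → substT u x (var x) ≡ u
  substTs-self : ∀ us x → substTs us x (var x) ≡ us
  substT-self (var y) x = if-does-≡ (y ℕ.≟ x) (cong var ∘ sym) refl
  substT-self (app g us) x = cong (app g) (substTs-self us x)
  substTs-self [] x = refl
  substTs-self (u ∷ us) x = cong₂ _∷_ (substT-self u x) (substTs-self us x)

  subst-self : ∀ A x → A [ x ≔ var x ] ≡ A
  subst-self (prim p us) x = cong (prim p) (substTs-self us x)
  subst-self (neg f A) x = cong (neg f) (subst-self A x)
  subst-self (tensor U A B) x = cong₂ (tensor U) (subst-self A x) (subst-self B x)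
  subst-self (with& U A B) x = cong₂ (with& U) (subst-self A x) (subst-self B x)
  subst-self (bang U A) x = cong (bang U) (subst-self A x)
  subst-self (forAll U y A) x =
    if-does-≡ (y ℕ.≟ x) (λ _ → refl) (cong (forAll U y) (subst-self A x))

  bound-∉-fv : ∀ U x A → x ∉ fv (forAll U x A)
  bound-∉-fv U x A x∈ = proj₂ (∈-filter⁻ (λ z → ¬? (z ℕ.≟ x)) {xs = fv A} x∈) refl

  freeFor-self : ∀ A x → FreeFor (var x) x A
  freeFor-self (prim p us) x = _
  freeFor-self (neg f A) x = freeFor-self A x
  freeFor-self (tensor U A B) x = freeFor-self A x , freeFor-self B x
  freeFor-self (with& U A B) x = freeFor-self A x , freeFor-self B x
  freeFor-self (bang U A) x = freeFor-self A x
  freeFor-self (forAll U y A) x with y ℕ.≟ x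
  ... | yes refl = inj₁ (bound-∉-fv U y A)
  ... | no y≢x = inj₂ ((λ { (here y≡x) → y≢x y≡x ; (there ()) }) , freeFor-self A x)

  ∉-fvSeq : ∀ {x} {Γ : Sequent} → All (λ φ → x ∉ fvI φ) Γ → x ∉ fvSeq Γ
  ∉-fvSeq x∉ = All¬⇒¬Any x∉ ∘ ∈-concatMap⁻ fvI

  ∀-neg-self : ∀ {Γ R U x A} → ¬ mem U R → ⊢ R ⟦ A ⟧ ∷ Γ → ⊢ R ⟦ forAll U x A ⟧ ∷ Γ
  ∀-neg-self {Γ} {R} {x = x} {A} R∉U d =
    ∀-neg (var x) R∉U (freeFor-self A x) (subst (λ C → ⊢ R ⟦ C ⟧ ∷ Γ) (sym (subst-self A x)) d)

  module _ {m} (R : Fin (suc m) → RoleSet) (i : Fin (suc m)) where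

    others : Formula → Sequent
    others C = tabulate (λ j → R (punchIn i j) ⟦ C ⟧)

    focus-block : ∀ {C} → ⊢ tabulate (λ k → R k ⟦ C ⟧) → ⊢ R i ⟦ C ⟧ ∷ others C
    focus-block {C} = exch (focus (λ k → R k ⟦ C ⟧) i)

    unfocus-block : ∀ {C} → ⊢ R i ⟦ C ⟧ ∷ others C → ⊢ tabulate (λ k → R k ⟦ C ⟧)
    unfocus-block {C} = exch (↭-sym (focus (λ k → R k ⟦ C ⟧) i))

    retag-others : ∀ {φ C D} → (∀ j → R (punchIn i j) ⟦ C ⟧ ∷ [] ⇝ R (punchIn i j) ⟦ D ⟧ ∷ []) →
      ⊢ φ ∷ others C → ⊢ φ ∷ others D
    retag-others {φ} r = ⇝-run (⇝-++ (⇝-refl {φ ∷ []}) (⇝-tabulate r))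

  identity-expansion : ∀ A {n} (R : Fin n → RoleSet) → Partition R →
    ⊢ tabulate (λ i → R i ⟦ A ⟧)
  identity-expansion (prim p us) R P = Id R P p us
  identity-expansion (neg f A) R P =
    ⇝-run (⇝-tabulate λ _ _ → ¬-rule)
      (identity-expansion A (preimage f ∘ R) (preimage-partition f P))
  -- An empty partition forces Ω = ∅, which carries no ultrafilter.
  identity-expansion (tensor U A B) {zero} R P = ⊥-elim (¬Fin0 (proj₁ (block U P)))
  identity-expansion (with& U A B) {zero} R P = ⊥-elim (¬Fin0 (proj₁ (block U P)))
  identity-expansion (bang U A) {zero} R P = ⊥-elim (¬Fin0 (proj₁ (block U P)))
  identity-expansion (forAll U x A) {zero} R P = ⊥-elim (¬Fin0 (proj₁ (block U P)))
  identity-expansion (tensor U A B) {suc m} R P with principal-block P U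
  ... | i , Rᵢ∈U , Rⱼ∉U = unfocus-block R i
    (⇝-run (⇝-++ ⇝-refl (⇝-tabulate₂ λ j _ → ⊗-neg (Rⱼ∉U j)))
      (⊗-pos Rᵢ∈U (focus-block R i (identity-expansion A R P))
                  (focus-block R i (identity-expansion B R P))))
  identity-expansion (with& U A B) {suc m} R P with principal-block P U
  ... | i , Rᵢ∈U , Rⱼ∉U = unfocus-block R i (&-pos Rᵢ∈U
    (retag-others R i (λ j _ → &-neg-l (Rⱼ∉U j))
      (focus-block R i (identity-expansion A R P)))
    (retag-others R i (λ j _ → &-neg-r (Rⱼ∉U j))
      (focus-block R i (identity-expansion B R P))))
  identity-expansion (bang U A) {suc m} R P with principal-block P U
  ... | i , Rᵢ∈U , Rⱼ∉U = unfocus-block R i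
    (!-pos Rᵢ∈U (tabulate⁺ λ j → U , A , refl , Rⱼ∉U j)
      (retag-others R i (λ j _ → !-neg-derelict (Rⱼ∉U j))
        (focus-block R i (identity-expansion A R P))))
  identity-expansion (forAll U x A) {suc m} R P with principal-block P U
  ... | i , Rᵢ∈U , Rⱼ∉U = unfocus-block R i
    (∀-pos Rᵢ∈U (∉-fvSeq {Γ = others R i (forAll U x A)} (tabulate⁺ λ _ → bound-∉-fv U x A))
      (retag-others R i (λ j _ → ∀-neg-self (Rⱼ∉U j))
        (focus-block R i (identity-expansion A R P))))

lemma10 : (Ω Fun Pred : Set) → let open LMRL Ω Fun Pred in
    ∀ (n : ℕ) (R : Fin n → RoleSet) → Partition R →
    ∀ (A : Formula) → ⊢ tabulate (λ i → R i ⟦ A ⟧)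
lemma10 Ω Fun Pred n R P A = IdentityExpansion.identity-expansion Ω Fun Pred A R P
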